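{- Let $\Sigma=\mathrm{PG}(n,q)$ and let $K$ be a set of points of $\Sigma$ of type $(a,b,c)_{n-1}$, with $|K|=k$. Suppose that there are integers $\alpha,\beta$ with $\gcd(\alpha,\beta)=1$ such that $a\equiv b\equiv c\equiv \theta_{n-1}\equiv \alpha \pmod{\beta}$. Then $k\equiv \theta_n \pmod{\beta}$.
   Context: $\theta_m=\frac{q^{m+1}-1}{q-1}$ denotes the number of points of $\mathrm{PG}(m,q)$. A set of points $K$ in $\mathrm{PG}(n,q)$ is of type $(m_1,\dots,m_r)_d$ if every $d$-dimensional subspace meets $K$ in $m_i$ points for some $i$, and for every $i$ there is some $d$-dimensional subspace meeting $K$ in exactly $m_i$ points. Here $a,b,c$ are distinct. -}

module Defs where

open import Level using (Level; _⊔_) renaming (suc to lsuc)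
open import Algebra.Bundles using (CommutativeRing)
open import Data.Bool using (Bool; true; false; _∧_; if_then_else_)
open import Data.Nat as ℕ using (ℕ; zero; suc; _^_)
open import Data.Integer as ℤ using (ℤ; _-_)
open import Data.Integer.Divisibility using (_∣_)
open import Data.List using (List; []; _∷_; [_]; map; concatMap; length; filterᵇ)
open import Data.List.Relation.Unary.Any using (Any)
open import Data.List.Relation.Unary.AllPairs using (AllPairs)
import Data.Vec as V
open V using (Vec)
import Data.Vec.Relation.Unary.All as VAll
open import Data.Product using (∃; Σ; _×_)
open import Data.Sum using (_⊎_)
open import Relation.Binary.Core using (Rel)
open import Relation.Binary.Definitions using (Decidable)
open import Relation.Binary.PropositionalEquality using (_≡_)
open import Relation.Nullary using (¬_; isYes)

record FiniteField (c ℓ : Level) : Set (lsuc (c ⊔ ℓ)) where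
  field
    commRing : CommutativeRing c ℓ
  open CommutativeRing commRing public hiding (ring)
  field
    0≉1      : ¬ (0# ≈ 1#)
    inverse  : ∀ x → ¬ (x ≈ 0#) → ∃ λ y → x * y ≈ 1#
    _≟_      : Decidable _≈_
    elements : List Carrier
    complete : ∀ x → Any (x ≈_) elements
    distinct : AllPairs (λ x y → ¬ (x ≈ y)) elements

  order : ℕ
  order = length elements

  allVecs : (m : ℕ) → List (Vec Carrier m)
  allVecs zero    = [ V.[] ]
  allVecs (suc m) = concatMap (λ x → map (x V.∷_) (allVecs m)) elements

  -- normalized representative of a projective point:
  -- nonzero vector whose first nonzero coordinate equals 1
  normalized : ∀ {m} → Vec Carrier m → Bool
  normalized V.[]       = false
  normalized (x V.∷ v) = if isYes (x ≟ 0#) then normalized v else isYes (x ≟ 1#)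

  points : (n : ℕ) → List (Vec Carrier (suc n))
  points n = filterᵇ normalized (allVecs (suc n))

  dot : ∀ {m} → Vec Carrier m → Vec Carrier m → Carrier
  dot V.[]       V.[]       = 0#
  dot (x V.∷ u) (y V.∷ v) = x * y + dot u v

  NonzeroVec : ∀ {m} → Vec Carrier m → Set (c ⊔ ℓ)
  NonzeroVec u = ¬ (VAll.All (λ x → x ≈ 0#) u)

-- A set of points of PG(n,q), given as a Boolean predicate on the
-- normalized representatives of the points.
PointSet : ∀ {c ℓ} → FiniteField c ℓ → ℕ → Set c
PointSet F n = Vec (FiniteField.Carrier F) (suc n) → Bool

module _ {c ℓ} (F : FiniteField c ℓ) where
  open FiniteField F

  size : (n : ℕ) → PointSet F n → ℕ
  size n K = length (filterᵇ K (points n))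

  -- |K ∩ H| where H is the hyperplane u·x = 0 (u a nonzero vector)
  meet : (n : ℕ) → PointSet F n → Vec Carrier (suc n) → ℕ
  meet n K u = length (filterᵇ (λ v → K v ∧ isYes (dot u v ≟ 0#)) (points n))

  HasType3 : (n : ℕ) → PointSet F n → ℕ → ℕ → ℕ → Set (c ⊔ ℓ)
  HasType3 n K a b c' =
    (∀ u → NonzeroVec u → (meet n K u ≡ a) ⊎ (meet n K u ≡ b) ⊎ (meet n K u ≡ c'))
    × (Σ (Vec Carrier (suc n)) λ u → NonzeroVec u × meet n K u ≡ a)
    × (Σ (Vec Carrier (suc n)) λ u → NonzeroVec u × meet n K u ≡ b)
    × (Σ (Vec Carrier (suc n)) λ u → NonzeroVec u × meet n K u ≡ c')

-- Σ_{i<m} q^i ; so θ_{m-1} = thetaBelow q m (with θ_{-1} = 0)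
thetaBelow : ℕ → ℕ → ℕ
thetaBelow q zero    = 0
thetaBelow q (suc m) = thetaBelow q m ℕ.+ q ^ m

-- θ_m = (q^{m+1}-1)/(q-1) = number of points of PG(m,q)
θ : ℕ → ℕ → ℕ
θ q m = thetaBelow q (suc m)

_≣_[mod_] : ℤ → ℤ → ℤ → Set
x ≣ y [mod β ] = β ∣ (x - y)

-- Count the incident pairs (point of K, hyperplane).  Every point lies on θ_{n-1}
-- hyperplanes, so the pairs number k·θ_{n-1}; grouped by hyperplane they number
-- the sum over the θ_n hyperplanes H of |K ∩ H| ∈ {a, b, c}, which is ≡ α·θ_n
-- (mod β).  As θ_{n-1} ≡ α, this gives α·k ≡ α·θ_n, and α is a unit mod β.
-- Hyperplanes are indexed by the same normalized vectors as points; the number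
-- of those through a point is computed by splitting off the first coordinate,
-- which reduces it to counting the solutions of affine equations s + u·v = t
-- (q^m of them in F^(m+1) when v ≠ 0).
module Submission where

open import Data.Bool using (Bool; true; false; _∧_; if_then_else_)
open import Data.List using (List; []; _∷_; map; concatMap; length; filterᵇ; _++_)
open import Data.List.Relation.Unary.All using (All; []; _∷_)
open import Data.Nat using (ℕ; zero; suc)
open import Function.Bundles using (mk⇔)
open import Relation.Binary.PropositionalEquality
  using (_≡_; _≢_; refl; sym; trans; cong; cong₂; subst; module ≡-Reasoning)
open import Relation.Nullary using (Dec; ¬_; isYes)
open import Relation.Nullary.Decidable using (isYes≗does; dec-true; dec-false; does-⇔)

open import Defs

𝟙 : Bool → ℕ
𝟙 b = if b then 1 else 0

isYes-true : ∀ {p} {P : Set p} (P? : Dec P) → P → isYes P? ≡ true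
isYes-true P? p = trans (isYes≗does P?) (dec-true P? p)

isYes-false : ∀ {p} {P : Set p} (P? : Dec P) → ¬ P → isYes P? ≡ false
isYes-false P? ¬p = trans (isYes≗does P?) (dec-false P? ¬p)

isYes-cong : ∀ {p r} {P : Set p} {R : Set r} → (P → R) → (R → P) →
             (P? : Dec P) (R? : Dec R) → isYes P? ≡ isYes R?
isYes-cong to from P? R? =
  trans (isYes≗does P?) (trans (does-⇔ (mk⇔ to from) P? R?) (sym (isYes≗does R?)))

module Sums where

  open import Data.Nat using (_+_; _*_)
  import Data.Nat.Properties as ℕₚ
  open import Algebra.Properties.CommutativeSemigroup ℕₚ.+-commutativeSemigroup
    using (interchange)

  module _ {a} {A : Set a} where

    ∑ : List A → (A → ℕ) → ℕ
    ∑ []       f = 0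
    ∑ (x ∷ xs) f = f x + ∑ xs f

    syntax ∑ xs (λ x → e) = ∑[ x ∈ xs ] e

    ∑-cong : ∀ {f g : A → ℕ} → (∀ x → f x ≡ g x) → ∀ xs → ∑ xs f ≡ ∑ xs g
    ∑-cong f≗g []       = refl
    ∑-cong f≗g (x ∷ xs) = cong₂ _+_ (f≗g x) (∑-cong f≗g xs)

    ∑-cong-All : ∀ {f g : A → ℕ} {xs} → All (λ x → f x ≡ g x) xs → ∑ xs f ≡ ∑ xs g
    ∑-cong-All []             = refl
    ∑-cong-All (fx≡gx ∷ fxs≡gxs) = cong₂ _+_ fx≡gx (∑-cong-All fxs≡gxs)

    ∑-const : ∀ c xs → ∑[ _ ∈ xs ] c ≡ length xs * c
    ∑-const c []       = refl
    ∑-const c (x ∷ xs) = cong (c +_) (∑-const c xs)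

    ∑-zero : ∀ xs → ∑[ _ ∈ xs ] 0 ≡ 0
    ∑-zero xs = trans (∑-const 0 xs) (ℕₚ.*-zeroʳ (length xs))

    ∑-++ : ∀ f xs ys → ∑ (xs ++ ys) f ≡ ∑ xs f + ∑ ys f
    ∑-++ f []       ys = refl
    ∑-++ f (x ∷ xs) ys = trans (cong (f x +_) (∑-++ f xs ys)) (sym (ℕₚ.+-assoc (f x) _ _))

    ∑-+ : ∀ f g xs → ∑[ x ∈ xs ] (f x + g x) ≡ ∑ xs f + ∑ xs g
    ∑-+ f g []       = refl
    ∑-+ f g (x ∷ xs) =
      trans (cong (f x + g x +_) (∑-+ f g xs)) (interchange (f x) (g x) (∑ xs f) (∑ xs g))

    ∑-*ʳ : ∀ f c xs → ∑[ x ∈ xs ] (f x * c) ≡ ∑ xs f * c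
    ∑-*ʳ f c []       = refl
    ∑-*ʳ f c (x ∷ xs) =
      trans (cong (f x * c +_) (∑-*ʳ f c xs)) (sym (ℕₚ.*-distribʳ-+ c (f x) (∑ xs f)))

    ∑-𝟙-∧ : ∀ b (p : A → Bool) xs → ∑[ x ∈ xs ] 𝟙 (b ∧ p x) ≡ 𝟙 b * ∑[ x ∈ xs ] 𝟙 (p x)
    ∑-𝟙-∧ true  p xs = sym (ℕₚ.+-identityʳ _)
    ∑-𝟙-∧ false p xs = ∑-zero xs

    length-filterᵇ : ∀ p xs → length (filterᵇ p xs) ≡ ∑[ x ∈ xs ] 𝟙 (p x)
    length-filterᵇ p []       = refl
    length-filterᵇ p (x ∷ xs) with p x
    ... | true  = cong suc (length-filterᵇ p xs)
    ... | false = length-filterᵇ p xs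

    ∑-filterᵇ : ∀ p f xs → ∑ (filterᵇ p xs) f ≡ ∑[ x ∈ xs ] (if p x then f x else 0)
    ∑-filterᵇ p f []       = refl
    ∑-filterᵇ p f (x ∷ xs) with p x
    ... | true  = cong (f x +_) (∑-filterᵇ p f xs)
    ... | false = ∑-filterᵇ p f xs

  module _ {a b} {A : Set a} {B : Set b} where

    ∑-map : ∀ (f : B → ℕ) (g : A → B) xs → ∑ (map g xs) f ≡ ∑[ x ∈ xs ] f (g x)
    ∑-map f g []       = refl
    ∑-map f g (x ∷ xs) = cong (f (g x) +_) (∑-map f g xs)

    ∑-concatMap : ∀ (f : B → ℕ) (g : A → List B) xs →
                  ∑ (concatMap g xs) f ≡ ∑[ x ∈ xs ] ∑ (g x) f
    ∑-concatMap f g []       = refl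
    ∑-concatMap f g (x ∷ xs) =
      trans (∑-++ f (g x) _) (cong (∑ (g x) f +_) (∑-concatMap f g xs))

    ∑-comm : ∀ (h : A → B → ℕ) xs ys →
             ∑[ x ∈ xs ] ∑[ y ∈ ys ] h x y ≡ ∑[ y ∈ ys ] ∑[ x ∈ xs ] h x y
    ∑-comm h []       ys = sym (∑-zero ys)
    ∑-comm h (x ∷ xs) ys =
      trans (cong (∑ ys (h x) +_) (∑-comm h xs ys)) (sym (∑-+ (h x) _ ys))

open Sums

open import Data.Integer using (ℤ; +_; 1ℤ)
open import Data.Integer.GCD using (gcd)

module Congruence (β : ℤ) where

  open import Data.Integer using (_+_; _-_; _*_; -_; ∣_∣)
  import Data.Integer.Properties as ℤₚ
  import Data.Integer.Divisibility.Signed as Signed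
  open Signed using (∣ᵤ⇒∣; ∣⇒∣ᵤ; ∣m∣n⇒∣m+n)
  open import Data.Integer.Tactic.RingSolver using (solve-∀)
  import Data.Nat as ℕ
  open import Data.Nat.Divisibility using (_∣_; _∣0)
  open import Data.Nat.Coprimality as Coprime using (Coprime; coprime-divisor; gcd≡1⇒coprime)

  -- The congruence of Defs uses unsigned divisibility; all reasoning happens with
  -- the signed one, which has the ring-compatibility lemmas.
  private
    from-signed : ∀ {u} x y → u ≡ x - y → β Signed.∣ u → x ≣ y [mod β ]
    from-signed x y refl = ∣⇒∣ᵤ

    to-signed : ∀ x y → x ≣ y [mod β ] → β Signed.∣ (x - y)
    to-signed x y = ∣ᵤ⇒∣

  ≣-sym : ∀ x y → x ≣ y [mod β ] → y ≣ x [mod β ]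
  ≣-sym x y x≣y = from-signed y x (lemma x y) (Signed.∣m⇒∣-m (to-signed x y x≣y))
    where
    lemma : ∀ x y → - (x - y) ≡ y - x
    lemma = solve-∀

  ≣-trans : ∀ x y z → x ≣ y [mod β ] → y ≣ z [mod β ] → x ≣ z [mod β ]
  ≣-trans x y z x≣y y≣z =
    from-signed x z (lemma x y z) (∣m∣n⇒∣m+n (to-signed x y x≣y) (to-signed y z y≣z))
    where
    lemma : ∀ x y z → (x - y) + (y - z) ≡ x - z
    lemma = solve-∀

  ≣-*-congˡ : ∀ k x y → x ≣ y [mod β ] → (k * x) ≣ (k * y) [mod β ]
  ≣-*-congˡ k x y x≣y =
    from-signed (k * x) (k * y) (lemma k x y) (Signed.∣n⇒∣m*n k (to-signed x y x≣y))
    where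
    lemma : ∀ k x y → k * (x - y) ≡ k * x - k * y
    lemma = solve-∀

  ≣-*-cancelˡ : ∀ α x y → gcd α β ≡ 1ℤ → (α * x) ≣ (α * y) [mod β ] → x ≣ y [mod β ]
  ≣-*-cancelˡ α x y gcd≡1 αx≣αy = coprime-divisor β⊥α β∣α[x-y]
    where
    β⊥α : Coprime ∣ β ∣ ∣ α ∣
    β⊥α = Coprime.sym (gcd≡1⇒coprime (cong ∣_∣ gcd≡1))

    lemma : ∀ α x y → α * x - α * y ≡ α * (x - y)
    lemma = solve-∀

    β∣α[x-y] : ∣ β ∣ ∣ (∣ α ∣ ℕ.* ∣ x - y ∣)
    β∣α[x-y] = subst (∣ β ∣ ∣_) (trans (cong ∣_∣ (lemma α x y)) (ℤₚ.abs-* α (x - y))) αx≣αy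

  ∑-≣ : ∀ {a} {A : Set a} (f : A → ℕ) α xs → All (λ x → (+ f x) ≣ α [mod β ]) xs →
        (+ ∑ xs f) ≣ (α * + length xs) [mod β ]
  ∑-≣ f α [] [] = from-signed (+ 0) (α * + 0) (lemma α) (∣ᵤ⇒∣ (∣ β ∣ ∣0))
    where
    lemma : ∀ α → + 0 ≡ + 0 - α * + 0
    lemma = solve-∀
  ∑-≣ f α (x ∷ xs) (fx≣α ∷ fxs≣α) =
    from-signed (+ ∑ (x ∷ xs) f) (α * + length (x ∷ xs)) split
      (∣m∣n⇒∣m+n (to-signed (+ f x) α fx≣α)
                  (to-signed (+ ∑ xs f) (α * + length xs) (∑-≣ f α xs fxs≣α)))
    where
    lemma : ∀ a s α l → (a - α) + (s - α * l) ≡ (a + s) - α * (+ 1 + l)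
    lemma = solve-∀

    split : (+ f x - α) + (+ ∑ xs f - α * + length xs)
          ≡ + ∑ (x ∷ xs) f - α * + length (x ∷ xs)
    split = trans (lemma (+ f x) (+ ∑ xs f) α (+ length xs))
      (sym (cong₂ (λ s l → s - α * l) (ℤₚ.pos-+ (f x) (∑ xs f)) (ℤₚ.pos-+ 1 (length xs))))


module Counting {c ℓ} (F : FiniteField c ℓ) where

  import Data.Nat as ℕ
  import Data.Nat.Properties as ℕₚ
  open import Data.Nat using (_^_)
  open import Data.Bool.Properties using (T-≡)
  open import Data.Empty using (⊥; ⊥-elim)
  import Data.List.Relation.Unary.All as All
  open import Data.List.Relation.Unary.All.Properties using (all-filter)
  open import Data.List.Relation.Unary.Any using (Any; here; there)
  open import Data.List.Relation.Unary.AllPairs using (AllPairs; []; _∷_)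
  open import Data.Product using (_×_; _,_; proj₂)
  open import Data.Sum using (_⊎_; inj₁; inj₂)
  open import Data.Vec using (Vec; []; _∷_)
  import Data.Vec.Relation.Unary.All as VAll
  open import Function using (_∘_)
  open import Function.Bundles using (Equivalence)
  open import Relation.Nullary using (yes; no)
  open import Relation.Nullary.Decidable using (T?)

  open FiniteField F hiding (zero)
    renaming (refl to ≈-refl; sym to ≈-sym; trans to ≈-trans)

  isYes-respˡ : ∀ {x y t} → x ≈ y → isYes (x ≟ t) ≡ isYes (y ≟ t)
  isYes-respˡ x≈y = isYes-cong (≈-trans (≈-sym x≈y)) (≈-trans x≈y) _ _

  ∑-elements-unique : ∀ x₀ (g : Carrier → ℕ) {G} →
    (∀ x → x ≈ x₀ → g x ≡ G) → (∀ x → ¬ x ≈ x₀ → g x ≡ 0) → ∑ elements g ≡ G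
  ∑-elements-unique x₀ g {G} on off = go elements distinct (complete x₀)
    where
    vanishes : ∀ {xs} → All (λ x → ¬ x ≈ x₀) xs → ∑ xs g ≡ 0
    vanishes []                     = refl
    vanishes {x ∷ _} (x≉x₀ ∷ xs≉x₀) = cong₂ ℕ._+_ (off x x≉x₀) (vanishes xs≉x₀)

    go : ∀ xs → AllPairs (λ x y → ¬ x ≈ y) xs → Any (x₀ ≈_) xs → ∑ xs g ≡ G
    go (x ∷ xs) (x≉xs ∷ _) (here x₀≈x) =
      trans (cong₂ ℕ._+_ (on x (≈-sym x₀≈x)) (vanishes (All.map xs≉x₀ x≉xs)))
            (ℕₚ.+-identityʳ G)
      where
      xs≉x₀ : ∀ {y} → ¬ x ≈ y → ¬ y ≈ x₀
      xs≉x₀ x≉y y≈x₀ = x≉y (≈-trans (≈-sym x₀≈x) (≈-sym y≈x₀))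
    go (x ∷ xs) (x≉xs ∷ xs-distinct) (there x₀∈xs) =
      cong₂ ℕ._+_ (off x x≉x₀) (go xs xs-distinct x₀∈xs)
      where
      x≉x₀ : ¬ x ≈ x₀
      x≉x₀ x≈x₀ =
        All.lookupWith {R = λ _ → ⊥} (λ x≉y x₀≈y → x≉y (≈-trans x≈x₀ x₀≈y)) x≉xs x₀∈xs

  ∑-elements-if : ∀ x₀ G → ∑[ x ∈ elements ] (if isYes (x ≟ x₀) then G else 0) ≡ G
  ∑-elements-if x₀ G = ∑-elements-unique x₀ _
    (λ x x≈x₀ → cong (λ b → if b then G else 0) (isYes-true (x ≟ x₀) x≈x₀))
    (λ x x≉x₀ → cong (λ b → if b then G else 0) (isYes-false (x ≟ x₀) x≉x₀))

  ∑-elements-0-1 : ∀ (g : Carrier → ℕ) {G₀ G₁} →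
    (∀ x → x ≈ 0# → g x ≡ G₀) → (∀ x → x ≈ 1# → g x ≡ G₁) →
    (∀ x → ¬ x ≈ 0# → ¬ x ≈ 1# → g x ≡ 0) → ∑ elements g ≡ G₀ ℕ.+ G₁
  ∑-elements-0-1 g {G₀} {G₁} on0 on1 off = begin
    ∑ elements g
      ≡⟨ ∑-cong split elements ⟩
    ∑[ x ∈ elements ] (at 0# G₀ x ℕ.+ at 1# G₁ x)
      ≡⟨ ∑-+ (at 0# G₀) (at 1# G₁) elements ⟩
    ∑ elements (at 0# G₀) ℕ.+ ∑ elements (at 1# G₁)
      ≡⟨ cong₂ ℕ._+_ (∑-elements-if 0# G₀) (∑-elements-if 1# G₁) ⟩
    G₀ ℕ.+ G₁
      ∎
    where
    open ≡-Reasoning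
    at : Carrier → ℕ → Carrier → ℕ
    at x₀ G x = if isYes (x ≟ x₀) then G else 0

    split : ∀ x → g x ≡ at 0# G₀ x ℕ.+ at 1# G₁ x
    split x with x ≟ 0# | x ≟ 1#
    ... | yes x≈0 | yes x≈1 = ⊥-elim (0≉1 (≈-trans (≈-sym x≈0) x≈1))
    ... | yes x≈0 | no _    = trans (on0 x x≈0) (sym (ℕₚ.+-identityʳ G₀))
    ... | no _    | yes x≈1 = on1 x x≈1
    ... | no x≉0  | no x≉1  = off x x≉0 x≉1

  ∑-allVecs-suc : ∀ m (h : Vec Carrier (suc m) → ℕ) →
    ∑ (allVecs (suc m)) h ≡ ∑[ x ∈ elements ] ∑[ u ∈ allVecs m ] h (x ∷ u)
  ∑-allVecs-suc m h = trans (∑-concatMap h _ elements)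
                            (∑-cong (λ x → ∑-map h (x ∷_) (allVecs m)) elements)

  count-allVecs : ∀ m → ∑[ _ ∈ allVecs m ] 1 ≡ order ^ m
  count-allVecs zero    = refl
  count-allVecs (suc m) = trans (∑-allVecs-suc m (λ _ → 1))
    (trans (∑-cong (λ _ → count-allVecs m) elements) (∑-const (order ^ m) elements))

  normalized-0∷ : ∀ {m x} (u : Vec Carrier m) → x ≈ 0# → normalized (x ∷ u) ≡ normalized u
  normalized-0∷ {x = x} u x≈0 =
    cong (λ b → if b then normalized u else isYes (x ≟ 1#)) (isYes-true (x ≟ 0#) x≈0)

  normalized-1∷ : ∀ {m x} (u : Vec Carrier m) → x ≈ 1# → normalized (x ∷ u) ≡ true
  normalized-1∷ {x = x} u x≈1 = trans
    (cong (λ b → if b then normalized u else isYes (x ≟ 1#))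
          (isYes-false (x ≟ 0#) (λ x≈0 → 0≉1 (≈-trans (≈-sym x≈0) x≈1))))
    (isYes-true (x ≟ 1#) x≈1)

  normalized-other∷ : ∀ {m x} (u : Vec Carrier m) → ¬ x ≈ 0# → ¬ x ≈ 1# →
                      normalized (x ∷ u) ≡ false
  normalized-other∷ {x = x} u x≉0 x≉1 = trans
    (cong (λ b → if b then normalized u else isYes (x ≟ 1#)) (isYes-false (x ≟ 0#) x≉0))
    (isYes-false (x ≟ 1#) x≉1)

  normalized⇒nonzero : ∀ {m} (v : Vec Carrier m) → normalized v ≡ true → NonzeroVec v
  normalized⇒nonzero []      ()
  normalized⇒nonzero (x ∷ v) nv (x≈0 VAll.∷ v≈0) =
    normalized⇒nonzero v (trans (sym (normalized-0∷ v x≈0)) nv) v≈0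

  points-normalized : ∀ n → All (λ u → normalized u ≡ true) (points n)
  points-normalized n =
    All.map (Equivalence.to T-≡) (all-filter (T? ∘ normalized) (allVecs (suc n)))

  ∑ᴾ : (m : ℕ) → (Vec Carrier m → ℕ) → ℕ
  ∑ᴾ m h = ∑[ u ∈ allVecs m ] (if normalized u then h u else 0)

  ∑ᴾ-cong : ∀ m {h h′ : Vec Carrier m → ℕ} → (∀ u → h u ≡ h′ u) → ∑ᴾ m h ≡ ∑ᴾ m h′
  ∑ᴾ-cong m h≗h′ = ∑-cong (λ u → cong (λ n → if normalized u then n else 0) (h≗h′ u)) (allVecs m)

  ∑-points : ∀ n f → ∑ (points n) f ≡ ∑ᴾ (suc n) f
  ∑-points n f = ∑-filterᵇ normalized f (allVecs (suc n))

  -- PG(m) is PG(m-1) (leading coordinate 0) plus the affine space of vectors 1 ∷ u.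
  ∑ᴾ-suc : ∀ m (h : Vec Carrier (suc m) → ℕ) → (∀ {x y} u → x ≈ y → h (x ∷ u) ≡ h (y ∷ u)) →
    ∑ᴾ (suc m) h ≡ ∑ᴾ m (λ u → h (0# ∷ u)) ℕ.+ ∑[ u ∈ allVecs m ] h (1# ∷ u)
  ∑ᴾ-suc m h h-resp = trans (∑-allVecs-suc m _) (∑-elements-0-1 _ on0 on1 off)
    where
    term : ∀ {b b′ n n′} → b ≡ b′ → n ≡ n′ → (if b then n else 0) ≡ (if b′ then n′ else 0)
    term = cong₂ (λ b n → if b then n else 0)

    on0 : ∀ x → x ≈ 0# → _ ≡ ∑ᴾ m (λ u → h (0# ∷ u))
    on0 x x≈0 = ∑-cong (λ u → term (normalized-0∷ u x≈0) (h-resp u x≈0)) (allVecs m)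

    on1 : ∀ x → x ≈ 1# → _ ≡ ∑[ u ∈ allVecs m ] h (1# ∷ u)
    on1 x x≈1 = ∑-cong (λ u → term (normalized-1∷ u x≈1) (h-resp u x≈1)) (allVecs m)

    off : ∀ x → ¬ x ≈ 0# → ¬ x ≈ 1# → _ ≡ 0
    off x x≉0 x≉1 =
      trans (∑-cong (λ u → term (normalized-other∷ u x≉0 x≉1) refl) (allVecs m))
            (∑-zero (allVecs m))

  ∑ᴾ-1 : ∀ m → ∑ᴾ m (λ _ → 1) ≡ thetaBelow order m
  ∑ᴾ-1 zero    = refl
  ∑ᴾ-1 (suc m) =
    trans (∑ᴾ-suc m (λ _ → 1) (λ _ _ → refl)) (cong₂ ℕ._+_ (∑ᴾ-1 m) (count-allVecs m))

  length-points : ∀ n → length (points n) ≡ θ order n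
  length-points n = trans (length-filterᵇ normalized (allVecs (suc n))) (∑ᴾ-1 (suc n))

  IsZeroVec : ∀ {m} → Vec Carrier m → Set _
  IsZeroVec = VAll.All (_≈ 0#)

  nonzero-∷ : ∀ {m y} {v : Vec Carrier m} → NonzeroVec (y ∷ v) →
              (IsZeroVec v × (¬ y ≈ 0#)) ⊎ NonzeroVec v
  nonzero-∷ {v = v} y∷v≉0 with VAll.all? (_≟ 0#) v
  ... | yes v≈0 = inj₁ (v≈0 , λ y≈0 → y∷v≉0 (y≈0 VAll.∷ v≈0))
  ... | no  v≉0 = inj₂ v≉0

  module _ where
    open import Relation.Binary.Reasoning.Setoid setoid

    dot-zeroʳ : ∀ {m} (u v : Vec Carrier m) → IsZeroVec v → dot u v ≈ 0#
    dot-zeroʳ []      []      _                  = ≈-refl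
    dot-zeroʳ (x ∷ u) (y ∷ v) (y≈0 VAll.∷ v≈0) = begin
      x * y + dot u v ≈⟨ +-cong (≈-trans (*-cong ≈-refl y≈0) (zeroʳ x)) (dot-zeroʳ u v v≈0) ⟩
      0# + 0#         ≈⟨ +-identityˡ 0# ⟩
      0#              ∎

    +-≈0 : ∀ {s d} → d ≈ 0# → s + d ≈ s
    +-≈0 {s} d≈0 = ≈-trans (+-cong ≈-refl d≈0) (+-identityʳ s)

    module LinearRoot {y z : Carrier} (yz≈1 : y * z ≈ 1#) (s t : Carrier) where

      root : Carrier
      root = (t + - s) * z

      root-unique : ∀ {x} → s + x * y ≈ t → x ≈ root
      root-unique {x} s+xy≈t = begin
        x             ≈⟨ ≈-sym (*-identityʳ x) ⟩
        x * 1#        ≈⟨ *-cong ≈-refl (≈-sym yz≈1) ⟩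
        x * (y * z)   ≈⟨ ≈-sym (*-assoc x y z) ⟩
        (x * y) * z   ≈⟨ *-cong xy≈t-s ≈-refl ⟩
        root          ∎
        where
        xy≈t-s : x * y ≈ t + - s
        xy≈t-s = begin
          x * y             ≈⟨ ≈-sym (+-identityˡ (x * y)) ⟩
          0# + x * y        ≈⟨ +-cong (≈-sym (-‿inverseˡ s)) ≈-refl ⟩
          (- s + s) + x * y ≈⟨ +-assoc (- s) s (x * y) ⟩
          - s + (s + x * y) ≈⟨ +-cong ≈-refl s+xy≈t ⟩
          - s + t           ≈⟨ +-comm (- s) t ⟩
          t + - s           ∎

      root-solves : ∀ {x} → x ≈ root → s + x * y ≈ t
      root-solves {x} x≈root = begin
        s + x * y               ≈⟨ +-cong ≈-refl (*-cong x≈root ≈-refl) ⟩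
        s + ((t + - s) * z) * y ≈⟨ +-cong ≈-refl (*-assoc (t + - s) z y) ⟩
        s + (t + - s) * (z * y) ≈⟨ +-cong ≈-refl (*-cong ≈-refl (≈-trans (*-comm z y) yz≈1)) ⟩
        s + (t + - s) * 1#      ≈⟨ +-cong ≈-refl (*-identityʳ _) ⟩
        s + (t + - s)           ≈⟨ +-cong ≈-refl (+-comm t (- s)) ⟩
        s + (- s + t)           ≈⟨ ≈-sym (+-assoc s (- s) t) ⟩
        (s + - s) + t           ≈⟨ +-cong (-‿inverseʳ s) ≈-refl ⟩
        0# + t                  ≈⟨ +-identityˡ t ⟩
        t                       ∎

  affineSolutions : (m : ℕ) → Vec Carrier m → Carrier → Carrier → ℕ
  affineSolutions m v s t = ∑[ u ∈ allVecs m ] 𝟙 (isYes ((s + dot u v) ≟ t))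

  affineSolutions-∷ : ∀ m y (v : Vec Carrier m) s t →
    affineSolutions (suc m) (y ∷ v) s t ≡ ∑[ x ∈ elements ] affineSolutions m v (s + x * y) t
  affineSolutions-∷ m y v s t = trans (∑-allVecs-suc m _)
    (∑-cong (λ x → ∑-cong (λ u → cong 𝟙 (isYes-respˡ (≈-sym (+-assoc s (x * y) (dot u v)))))
                          (allVecs m))
            elements)

  affineSolutions-zero : ∀ m (v : Vec Carrier m) → IsZeroVec v → ∀ s t →
    affineSolutions m v s t ≡ (if isYes (s ≟ t) then order ^ m else 0)
  affineSolutions-zero m v v≈0 s t =
    trans (∑-cong (λ u → cong 𝟙 (isYes-respˡ (+-≈0 (dot-zeroʳ u v v≈0)))) (allVecs m))
          (constant (isYes (s ≟ t)))
    where
    constant : ∀ b → ∑[ _ ∈ allVecs m ] 𝟙 b ≡ (if b then order ^ m else 0)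
    constant true  = count-allVecs m
    constant false = ∑-zero (allVecs m)

  affineSolutions-nonzero : ∀ {m} (v : Vec Carrier (suc m)) → NonzeroVec v → ∀ s t →
    affineSolutions (suc m) v s t ≡ order ^ m
  affineSolutions-nonzero {m} (y ∷ v) y∷v≉0 s t with nonzero-∷ y∷v≉0
  ... | inj₁ (v≈0 , y≉0) =
    trans (affineSolutions-∷ m y v s t)
      (trans (∑-cong (λ x → affineSolutions-zero m v v≈0 (s + x * y) t) elements)
        (∑-elements-unique root _
          (λ x x≈root → cong choose (isYes-true  (_ ≟ t) (root-solves x≈root)))
          (λ x x≉root → cong choose (isYes-false (_ ≟ t) (x≉root ∘ root-unique)))))
    where
    open LinearRoot (proj₂ (inverse y y≉0)) s t
    choose : Bool → ℕ
    choose b = if b then order ^ m else 0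
  affineSolutions-nonzero (y ∷ [])           _ s t | inj₂ []≉0 = ⊥-elim ([]≉0 VAll.[])
  affineSolutions-nonzero (y ∷ v@(_ ∷ _)) _ s t | inj₂ v≉0 =
    trans (affineSolutions-∷ _ y v s t)
      (trans (∑-cong (λ x → affineSolutions-nonzero v v≉0 (s + x * y) t) elements)
             (∑-const _ elements))

  hyperplanesThrough : (m : ℕ) → Vec Carrier m → ℕ
  hyperplanesThrough m v = ∑ᴾ m (λ u → 𝟙 (isYes (dot u v ≟ 0#)))

  hyperplanesThrough-∷ : ∀ m y (v : Vec Carrier m) →
    hyperplanesThrough (suc m) (y ∷ v) ≡ hyperplanesThrough m v ℕ.+ affineSolutions m v y 0#
  hyperplanesThrough-∷ m y v = trans (∑ᴾ-suc m _ resp)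
    (cong₂ ℕ._+_ (∑ᴾ-cong m (λ u → cong 𝟙 (isYes-respˡ (0y+d≈d (dot u v)))))
                 (∑-cong (λ u → cong 𝟙 (isYes-respˡ (+-cong (*-identityˡ y) ≈-refl)))
                         (allVecs m)))
    where
    resp : ∀ {x x′} u → x ≈ x′ →
           𝟙 (isYes ((x * y + dot u v) ≟ 0#)) ≡ 𝟙 (isYes ((x′ * y + dot u v) ≟ 0#))
    resp u x≈x′ = cong 𝟙 (isYes-respˡ (+-cong (*-cong x≈x′ ≈-refl) ≈-refl))

    0y+d≈d : ∀ d → 0# * y + d ≈ d
    0y+d≈d d = ≈-trans (+-cong (zeroˡ y) ≈-refl) (+-identityˡ d)

  hyperplanesThrough-nonzero : ∀ {m} (v : Vec Carrier (suc m)) → NonzeroVec v →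
    hyperplanesThrough (suc m) v ≡ thetaBelow order m
  hyperplanesThrough-nonzero {m} (y ∷ v) y∷v≉0 with nonzero-∷ y∷v≉0
  ... | inj₁ (v≈0 , y≉0) =
    trans (hyperplanesThrough-∷ m y v)
      (trans (cong₂ ℕ._+_ allOfPG noSolution) (ℕₚ.+-identityʳ _))
    where
    allOfPG : hyperplanesThrough m v ≡ thetaBelow order m
    allOfPG = trans (∑ᴾ-cong m (λ u → cong 𝟙 (isYes-true (_ ≟ 0#) (dot-zeroʳ u v v≈0))))
                    (∑ᴾ-1 m)

    noSolution : affineSolutions m v y 0# ≡ 0
    noSolution = trans (affineSolutions-zero m v v≈0 y 0#)
                       (cong (λ b → if b then order ^ m else 0) (isYes-false (y ≟ 0#) y≉0))
  hyperplanesThrough-nonzero (y ∷ [])           _ | inj₂ []≉0 = ⊥-elim ([]≉0 VAll.[])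
  hyperplanesThrough-nonzero (y ∷ v@(_ ∷ _)) _ | inj₂ v≉0 =
    trans (hyperplanesThrough-∷ _ y v)
          (cong₂ ℕ._+_ (hyperplanesThrough-nonzero v v≉0) (affineSolutions-nonzero v v≉0 y 0#))

  hyperplanesThrough-point : ∀ n (v : Vec Carrier (suc n)) → normalized v ≡ true →
    ∑[ u ∈ points n ] 𝟙 (isYes (dot u v ≟ 0#)) ≡ thetaBelow order n
  hyperplanesThrough-point n v nv =
    trans (∑-points n _) (hyperplanesThrough-nonzero v (normalized⇒nonzero v nv))

  ∑-meet : ∀ n (K : PointSet F n) →
           ∑ (points n) (meet F n K) ≡ size F n K ℕ.* thetaBelow order n
  ∑-meet n K = begin
    ∑ P (meet F n K)
      ≡⟨ ∑-cong (λ u → length-filterᵇ _ P) P ⟩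
    ∑[ u ∈ P ] ∑[ v ∈ P ] 𝟙 (K v ∧ incident u v)
      ≡⟨ ∑-comm _ P P ⟩
    ∑[ v ∈ P ] ∑[ u ∈ P ] 𝟙 (K v ∧ incident u v)
      ≡⟨ ∑-cong (λ v → ∑-𝟙-∧ (K v) (λ u → incident u v) P) P ⟩
    ∑[ v ∈ P ] (𝟙 (K v) ℕ.* ∑[ u ∈ P ] 𝟙 (incident u v))
      ≡⟨ ∑-cong-All (All.map through (points-normalized n)) ⟩
    ∑[ v ∈ P ] (𝟙 (K v) ℕ.* thetaBelow order n)
      ≡⟨ ∑-*ʳ (𝟙 ∘ K) _ P ⟩
    ∑[ v ∈ P ] 𝟙 (K v) ℕ.* thetaBelow order n
      ≡⟨ cong (ℕ._* thetaBelow order n) (sym (length-filterᵇ K P)) ⟩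
    size F n K ℕ.* thetaBelow order n
      ∎
    where
    open ≡-Reasoning
    P : List (Vec Carrier (suc n))
    P = points n

    incident : Vec Carrier (suc n) → Vec Carrier (suc n) → Bool
    incident u v = isYes (dot u v ≟ 0#)

    through : ∀ {v} → normalized v ≡ true →
      𝟙 (K v) ℕ.* ∑[ u ∈ P ] 𝟙 (incident u v) ≡ 𝟙 (K v) ℕ.* thetaBelow order n
    through {v} nv = cong (𝟙 (K v) ℕ.*_) (hyperplanesThrough-point n v nv)

open import Data.Integer using (_*_)
import Data.Integer.Properties as ℤₚ
open import Data.Sum using (inj₁; inj₂)
open import Data.Product using (_,_)
import Data.List.Relation.Unary.All as All

mainTheorem1 : ∀ {c ℓ} (F : FiniteField c ℓ) (n : ℕ) (K : PointSet F n)
    (a b c' k : ℕ) → a ≢ b → a ≢ c' → b ≢ c' →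
    HasType3 F n K a b c' → size F n K ≡ k →
    (α β : ℤ) → gcd α β ≡ 1ℤ →
    (+ a) ≣ α [mod β ] → (+ b) ≣ α [mod β ] → (+ c') ≣ α [mod β ] →
    (+ thetaBelow (FiniteField.order F) n) ≣ α [mod β ] →
    (+ k) ≣ (+ θ (FiniteField.order F) n) [mod β ]
-- Neither the distinctness of a, b, c nor the attainment of each value is needed.
mainTheorem1 F n K a b c' k _ _ _ (meets , _) refl α β gcd≡1 a≣α b≣α c≣α θₙ₋₁≣α =
  subst (λ N → (+ k) ≣ (+ N) [mod β ]) (length-points n)
    (≣-*-cancelˡ α (+ k) (+ N) gcd≡1 αk≣αN)
  where
  open Counting F
  open FiniteField F using (order; normalized; points)
  open Congruence β

  N T : ℕ
  N = length (points n)
  T = thetaBelow order n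

  meet≣α : ∀ u → normalized u ≡ true → (+ meet F n K u) ≣ α [mod β ]
  meet≣α u nu with meets u (normalized⇒nonzero u nu)
  ... | inj₁ refl        = a≣α
  ... | inj₂ (inj₁ refl) = b≣α
  ... | inj₂ (inj₂ refl) = c≣α

  kT≣αN : (+ k * + T) ≣ (α * + N) [mod β ]
  kT≣αN = subst (λ x → x ≣ (α * + N) [mod β ])
    (trans (cong +_ (∑-meet n K)) (ℤₚ.pos-* k T))
    (∑-≣ (meet F n K) α (points n) (All.map (λ {u} → meet≣α u) (points-normalized n)))

  αk≣αN : (α * + k) ≣ (α * + N) [mod β ]
  αk≣αN = subst (λ x → x ≣ (α * + N) [mod β ]) (ℤₚ.*-comm (+ k) α)
    (≣-trans (+ k * α) (+ k * + T) (α * + N)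
      (≣-*-congˡ (+ k) α (+ T) (≣-sym (+ T) α θₙ₋₁≣α)) kT≣αN)
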